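{- Let $N > 1$ be an integer and let $C_N = (c_{i,j})_{i,j \in \mathbb{Z}_N}$ be the adjacency matrix of the modular Collatz graph $G_N$ (see context). Vertices are residues modulo $N$. Then: (a) The only vertices $n$ with $c_{n,n} \geq 1$ (loops) are $n = 0$ and $n = N-1$, and these loops occur for every $N$. (b) The only strongly double edges are $\frac{N-1}{2} \to \frac{N-1}{4}$ (doubled) when $N \equiv 1 \pmod 4$, and $\frac{N-1}{2} \to \frac{3N-1}{4}$ (doubled) when $N \equiv 3 \pmod 4$. (c) The only weakly double edges are: $\{1,2\}$ for all $N$; $\{\frac{1}{3}N, \frac{2}{3}N\}$ for all $N$ with $3 \mid N$; and $\{\frac15 N - 1, \frac45 N - 1\}$ and $\{\frac25 N - 1, \frac35 N - 1\}$ for all $N$ with $5 \mid N$. (d) For distinct vertices $n \neq t$ one always has $c_{n,t} + c_{t,n} \leq 3$, and equality (a triple edge) occurs only for $N = 3$ with $c_{1,2} = 2$, $c_{2,1} = 1$, and for $N = 5$ with $c_{1,2} = 1$, $c_{2,1} = 2$.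
   Context: The Collatz function is $T(n) = n/2$ if $n$ is even and $T(n) = (3n+1)/2$ if $n$ is odd, for nonnegative integers $n$. For an integer $N > 1$ the modular Collatz graph $G_N$ has vertex set $\mathbb{Z}_N = \{0,1,\ldots,N-1\}$, and its adjacency matrix $C_N = (c_{i,j})$ is given by $c_{i,j} = \#\{\nu \in \{i, i+N\} : T(\nu) \equiv j \pmod N\}$ (since $T(\nu + 2N) \equiv T(\nu) \pmod N$, this counts the edges $i \to j$ arising from all integers $\nu \equiv i \pmod N$; every vertex has out-degree $2$). An edge $n \to t$ with $n \neq t$ is strongly double if $c_{n,t} = 2$; an unordered pair $\{n,t\}$ with $n \neq t$ is a weakly double edge if $c_{n,t} \geq 1$ and $c_{t,n} \geq 1$. All vertex labels are read as residues modulo $N$. -}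

module Defs where

open import Data.Nat using (ℕ; zero; suc; _+_; _*_; NonZero)
open import Data.Nat.Properties using (_≟_)
open import Data.Nat.DivMod using (_/_; _%_)
open import Data.Bool using (if_then_else_)
open import Data.Product using (_×_)
open import Data.Sum using (_⊎_)
open import Relation.Nullary using (does)
open import Relation.Binary.PropositionalEquality using (_≡_)

T : ℕ → ℕ
T n with n % 2
... | zero  = n / 2
... | suc _ = (3 * n + 1) / 2

hit : (N : ℕ) .{{_ : NonZero N}} → ℕ → ℕ → ℕ
hit N ν j = if does ((T ν) % N ≟ j) then 1 else 0

-- Adjacency matrix entry c_{i,j} of the modular Collatz graph G_N:
-- c_{i,j} = #{ ν ∈ {i, i+N} : T ν ≡ j (mod N) }   (intended for i, j < N)
c : (N : ℕ) .{{_ : NonZero N}} → ℕ → ℕ → ℕ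
c N i j = hit N i j + hit N (i + N) j

SamePair : ℕ → ℕ → ℕ → ℕ → Set
SamePair n t a b = (n ≡ a × t ≡ b) ⊎ (n ≡ b × t ≡ a)

module Submission where

-- An edge n → t comes from a lift ν ∈ {n, n + N} with T ν ≡ t (mod N). Since 2 T ν is ν or
-- 3ν + 1, every edge satisfies 2t ≡ n or 2t ≡ 3n + 1 (mod N); conversely T (ν + 2N) ≡ T ν
-- (mod N), so any ν ≡ n (mod N) with T ν ≡ t (mod N) exhibits the edge n → t. A loop (t = n)
-- or a weakly double edge (a congruence in each direction) is thus a solution of linear
-- congruences, and since all vertices lie below N the quotients are bounded, which leaves
-- exactly the listed families. A strongly double edge needs both lifts to hit t; comparing
-- 2 T n with 2 T (n + N) modulo 2N forces N = 2n + 1 and t = T n. A triple edge is a weakly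
-- double edge with a strong direction, which leaves only the pairs {1, 2} for N = 3 and N = 5.

open import Defs
open import Data.Bool using (if_then_else_)
open import Data.List using (_∷_; [])
open import Data.Nat using (ℕ; zero; suc; pred; _+_; _*_; _∸_; _≤_; _<_; NonZero;
  z≤n; s≤s; z<s; >-nonZero⁻¹; ≢-nonZero⁻¹)
open import Data.Nat.DivMod using (_/_; _%_; m≡m%n+[m/n]*n; m%n<n; m<n⇒m%n≡m; m%n%n≡m%n;
  [m+n]%n≡m%n; [m+kn]%n≡m%n; m%n*o≡m*o%[n*o]; %-distribˡ-+; %-distribˡ-*; %-congʳ;
  m*[n/m]≡n; m*n/n≡m; m<n*o⇒m/o<n)
open import Data.Nat.Divisibility using (_∣_; divides)
open import Data.Nat.Properties
open import Data.Nat.Tactic.RingSolver using (solve; solve-∀)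
open import Data.Product using (_×_; _,_; ∃; proj₁; proj₂; swap)
open import Data.Sum using (_⊎_; inj₁; inj₂)
open import Function.Base using (_∘_)
open import Function.Bundles using (_⇔_; mk⇔)
open import Relation.Binary.Bundles using (Setoid)
import Relation.Binary.Construct.On as On
open import Relation.Binary.Construct.Closure.Symmetric using (SymClosure; fwd; bwd)
open import Relation.Binary.PropositionalEquality
import Relation.Binary.Reasoning.Setoid as SetoidReasoning
open import Relation.Nullary using (¬_; Dec; yes; no; does; contradiction)

data Parity : ℕ → Set where
  even : ∀ k → Parity (k * 2)
  odd  : ∀ k → Parity (1 + k * 2)

parity : ∀ n → Parity n
parity zero          = even 0
parity (suc zero)    = odd 0
parity (suc (suc n)) with parity n
... | even k = even (suc k)
... | odd k  = odd (suc k)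

division-form : ∀ {m r} d .{{_ : NonZero d}} → m % d ≡ r → m ≡ r + m / d * d
division-form {m} d m%d≡r = trans (m≡m%n+[m/n]*n m d) (cong (_+ m / d * d) m%d≡r)

exact-quotient : ∀ {m} q d .{{_ : NonZero d}} → m ≡ q * d → m / d ≡ q
exact-quotient q d m≡qd = trans (cong (_/ d) m≡qd) (m*n/n≡m q d)

m+n≡o+o⇒m≡o : ∀ {m n o} → m ≤ o → n ≤ o → m + n ≡ o + o → m ≡ o
m+n≡o+o⇒m≡o {m} {n} {o} m≤o n≤o m+n≡o+o = ≤-antisym m≤o (+-cancelˡ-≤ o o m (begin
  o + o     ≡⟨ m+n≡o+o ⟨
  m + n     ≤⟨ +-monoʳ-≤ m n≤o ⟩
  m + o     ≡⟨ +-comm m o ⟩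
  o + m     ∎))
  where open ≤-Reasoning

sum≤3 : ∀ {a b} → a ≤ 2 → b ≤ 2 → ¬ (a ≡ 2 × b ≡ 2) → a + b ≤ 3
sum≤3 a≤2 b≤2 not-both with m≤n⇒m<n∨m≡n a≤2 | m≤n⇒m<n∨m≡n b≤2
... | inj₁ (s≤s a≤1) | _              = +-mono-≤ a≤1 b≤2
... | inj₂ a≡2       | inj₁ (s≤s b≤1) = +-mono-≤ (≤-reflexive a≡2) b≤1
... | inj₂ a≡2       | inj₂ b≡2       = contradiction (a≡2 , b≡2) not-both

sum≡3 : ∀ {a b} → a ≤ 2 → b ≤ 2 → a + b ≡ 3 → (a ≡ 2 × 1 ≤ b) ⊎ (1 ≤ a × b ≡ 2)
sum≡3 (s≤s (s≤s z≤n)) (s≤s z≤n)       _ = inj₁ (refl , s≤s z≤n)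
sum≡3 (s≤s z≤n)       (s≤s (s≤s z≤n)) _ = inj₂ (s≤s z≤n , refl)
sum≡3 z≤n             z≤n             ()
sum≡3 z≤n             (s≤s z≤n)       ()
sum≡3 z≤n             (s≤s (s≤s z≤n)) ()
sum≡3 (s≤s z≤n)       z≤n             ()
sum≡3 (s≤s z≤n)       (s≤s z≤n)       ()
sum≡3 (s≤s (s≤s z≤n)) z≤n             ()
sum≡3 (s≤s (s≤s z≤n)) (s≤s (s≤s z≤n)) ()

infix 4 _≡_mod_
_≡_mod_ : ℕ → ℕ → (N : ℕ) → .{{NonZero N}} → Set
a ≡ b mod N = a % N ≡ b % N

≡-mod-setoid : (N : ℕ) .{{_ : NonZero N}} → Setoid _ _
≡-mod-setoid N = On.setoid (setoid ℕ) (_% N)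

module _ {N : ℕ} .{{_ : NonZero N}} where

  +-cong-mod : ∀ {a b c d} → a ≡ b mod N → c ≡ d mod N → a + c ≡ b + d mod N
  +-cong-mod {a} {b} {c} {d} a≡b c≡d = begin
    (a + c) % N               ≡⟨ %-distribˡ-+ a c N ⟩
    (a % N + c % N) % N       ≡⟨ cong₂ (λ x y → (x + y) % N) a≡b c≡d ⟩
    (b % N + d % N) % N       ≡⟨ %-distribˡ-+ b d N ⟨
    (b + d) % N               ∎
    where open ≡-Reasoning

  *-congˡ-mod : ∀ k {a b} → a ≡ b mod N → k * a ≡ k * b mod N
  *-congˡ-mod k {a} {b} a≡b = begin
    (k * a) % N               ≡⟨ %-distribˡ-* k a N ⟩
    (k % N * (a % N)) % N     ≡⟨ cong (λ x → (k % N * x) % N) a≡b ⟩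
    (k % N * (b % N)) % N     ≡⟨ %-distribˡ-* k b N ⟨
    (k * b) % N               ∎
    where open ≡-Reasoning

  *-scaleˡ-mod : ∀ k .{{_ : NonZero k}} .{{_ : NonZero (N * k)}} {a b} →
                 a ≡ b mod N → k * a ≡ k * b mod (N * k)
  *-scaleˡ-mod k {a} {b} a≡b = begin
    (k * a) % (N * k)   ≡⟨ cong (_% (N * k)) (*-comm k a) ⟩
    (a * k) % (N * k)   ≡⟨ m%n*o≡m*o%[n*o] a N k ⟨
    a % N * k           ≡⟨ cong (_* k) a≡b ⟩
    b % N * k           ≡⟨ m%n*o≡m*o%[n*o] b N k ⟩
    (b * k) % (N * k)   ≡⟨ cong (_% (N * k)) (*-comm b k) ⟩
    (k * b) % (N * k)   ∎
    where open ≡-Reasoning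

  -- c + c * pred N is a multiple of N, so adding c * pred N undoes the addition of c.
  +-cancelʳ-mod : ∀ c {a b} → a + c ≡ b + c mod N → a ≡ b mod N
  +-cancelʳ-mod c {a} {b} a+c≡b+c = begin
    a % N                          ≡⟨ [m+kn]%n≡m%n a c N ⟨
    (a + c * N) % N                ≡⟨ cong (_% N) (absorb a) ⟩
    (a + c + c * pred N) % N       ≡⟨ +-cong-mod a+c≡b+c refl ⟩
    (b + c + c * pred N) % N       ≡⟨ cong (_% N) (absorb b) ⟨
    (b + c * N) % N                ≡⟨ [m+kn]%n≡m%n b c N ⟩
    b % N                          ∎
    where
    open ≡-Reasoning
    absorb : ∀ x → x + c * N ≡ x + c + c * pred N
    absorb x = begin
      x + c * N                ≡⟨ cong (λ y → x + c * y) (suc-pred N) ⟨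
      x + c * suc (pred N)     ≡⟨ cong (x +_) (*-suc c (pred N)) ⟩
      x + (c + c * pred N)     ≡⟨ +-assoc x c _ ⟨
      x + c + c * pred N       ∎

  +-cancelˡ-mod : ∀ c {a b} → c + a ≡ c + b mod N → a ≡ b mod N
  +-cancelˡ-mod c {a} {b} c+a≡c+b =
    +-cancelʳ-mod c (trans (cong (_% N) (+-comm a c)) (trans c+a≡c+b (cong (_% N) (+-comm c b))))

  residue≡mod : ∀ {x r} → x % N ≡ r → r ≡ x mod N
  residue≡mod {x} x%N≡r = trans (cong (_% N) (sym x%N≡r)) (m%n%n≡m%n x N)

  residue-of-lift : ∀ {x r} i → x ≡ r + i * N → r < N → x % N ≡ r
  residue-of-lift {x} {r} i x≡ r<N = begin
    x % N           ≡⟨ cong (_% N) x≡ ⟩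
    (r + i * N) % N ≡⟨ [m+kn]%n≡m%n r i N ⟩
    r % N           ≡⟨ m<n⇒m%n≡m r<N ⟩
    r               ∎
    where open ≡-Reasoning

  ≡-mod-small : ∀ {a b} → a < N → b < N → a ≡ b mod N → a ≡ b
  ≡-mod-small a<N b<N a≡b = trans (sym (m<n⇒m%n≡m a<N)) (trans a≡b (m<n⇒m%n≡m b<N))

  ≡0-mod⇒multiple : ∀ {x k} → x ≡ 0 mod N → x < k * N → ∃ λ j → j < k × x ≡ j * N
  ≡0-mod⇒multiple {x} x≡0 x<kN = x / N , m<n*o⇒m/o<n x<kN , (begin
    x                   ≡⟨ m≡m%n+[m/n]*n x N ⟩
    x % N + x / N * N   ≡⟨ cong (_+ x / N * N) (trans x≡0 (m<n⇒m%n≡m (>-nonZero⁻¹ N))) ⟩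
    x / N * N           ∎)
    where open ≡-Reasoning

T-spec : ∀ ν → 2 * T ν ≡ ν ⊎ 2 * T ν ≡ 3 * ν + 1
T-spec ν with ν % 2 | m%n<n ν 2 | m≡m%n+[m/n]*n ν 2
... | 0           | _            | ν≡2q   = inj₁ (m*[n/m]≡n (divides (ν / 2) ν≡2q))
... | 1           | _            | ν≡1+2q = inj₂ (m*[n/m]≡n (divides (2 + 3 * (ν / 2)) (begin
  3 * ν + 1                     ≡⟨ cong (λ x → 3 * x + 1) ν≡1+2q ⟩
  3 * (1 + ν / 2 * 2) + 1       ≡⟨ tripled-odd (ν / 2) ⟩
  (2 + 3 * (ν / 2)) * 2         ∎)))
  where
  open ≡-Reasoning
  tripled-odd : ∀ q → 3 * (1 + q * 2) + 1 ≡ (2 + 3 * q) * 2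
  tripled-odd = solve-∀
... | suc (suc _) | s≤s (s≤s ()) | _

3*[2*m]+1≡1+2*[3*m] : ∀ m → 3 * (2 * m) + 1 ≡ suc (2 * (3 * m))
3*[2*m]+1≡1+2*[3*m] = solve-∀

T-halve : ∀ {ν m} → 2 * m ≡ ν → T ν ≡ m
T-halve {ν} {m} 2m≡ν with T-spec ν
... | inj₁ 2Tν≡ν     = *-cancelˡ-≡ _ _ 2 (trans 2Tν≡ν (sym 2m≡ν))
... | inj₂ 2Tν≡3ν+1 = contradiction (begin
  2 * T ν           ≡⟨ 2Tν≡3ν+1 ⟩
  3 * ν + 1         ≡⟨ cong (λ x → 3 * x + 1) (sym 2m≡ν) ⟩
  3 * (2 * m) + 1   ≡⟨ 3*[2*m]+1≡1+2*[3*m] m ⟩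
  suc (2 * (3 * m)) ∎) (even≢odd (T ν) (3 * m))
  where open ≡-Reasoning

T-triple : ∀ {ν m} → 2 * m ≡ 3 * ν + 1 → T ν ≡ m
T-triple {ν} {m} 2m≡3ν+1 with T-spec ν
... | inj₂ 2Tν≡3ν+1 = *-cancelˡ-≡ _ _ 2 (trans 2Tν≡3ν+1 (sym 2m≡3ν+1))
... | inj₁ 2Tν≡ν     = contradiction (begin
  2 * m                 ≡⟨ 2m≡3ν+1 ⟩
  3 * ν + 1             ≡⟨ cong (λ x → 3 * x + 1) (sym 2Tν≡ν) ⟩
  3 * (2 * T ν) + 1     ≡⟨ 3*[2*m]+1≡1+2*[3*m] (T ν) ⟩
  suc (2 * (3 * T ν))   ∎) (even≢odd m (3 * T ν))
  where open ≡-Reasoning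

T-even : ∀ k → T (k * 2) ≡ k
T-even k = T-halve (*-comm 2 k)

T-odd : ∀ k → T (1 + k * 2) ≡ 2 + 3 * k
T-odd k = T-triple {1 + k * 2} (tripled k)
  where
  tripled : ∀ k → 2 * (2 + 3 * k) ≡ 3 * (1 + k * 2) + 1
  tripled = solve-∀

T<2n+1 : ∀ n → T n < 2 * n + 1
T<2n+1 n = *-cancelˡ-< 2 (T n) (2 * n + 1) (begin-strict
  2 * T n               ≤⟨ 2T≤3n+1 (T-spec n) ⟩
  3 * n + 1             <⟨ m<m+n (3 * n + 1) z<s ⟩
  3 * n + 1 + suc n     ≡⟨ solve (n ∷ []) ⟩
  2 * (2 * n + 1)       ∎)
  where
  open ≤-Reasoning
  2T≤3n+1 : 2 * T n ≡ n ⊎ 2 * T n ≡ 3 * n + 1 → 2 * T n ≤ 3 * n + 1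
  2T≤3n+1 (inj₁ 2Tn≡n)     = ≤-trans (≤-reflexive 2Tn≡n) (≤-trans (m≤m+n n (2 * n)) (m≤m+n _ 1))
  2T≤3n+1 (inj₂ 2Tn≡3n+1) = ≤-reflexive 2Tn≡3n+1

-- T (ν + 2N) is T ν + N or T ν + 3N.
T-mod-periodic : ∀ ν N .{{_ : NonZero N}} → T (ν + 2 * N) % N ≡ T ν % N
T-mod-periodic ν N with T-spec ν
... | inj₁ 2Tν≡ν = begin
  T (ν + 2 * N) % N   ≡⟨ cong (_% N) (T-halve (begin
                           2 * (T ν + N)       ≡⟨ *-distribˡ-+ 2 (T ν) N ⟩
                           2 * T ν + 2 * N     ≡⟨ cong (_+ 2 * N) 2Tν≡ν ⟩
                           ν + 2 * N           ∎)) ⟩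
  (T ν + N) % N       ≡⟨ [m+n]%n≡m%n (T ν) N ⟩
  T ν % N             ∎
  where open ≡-Reasoning
... | inj₂ 2Tν≡3ν+1 = begin
  T (ν + 2 * N) % N   ≡⟨ cong (_% N) (T-triple {ν + 2 * N} (begin
                           2 * (T ν + 3 * N)         ≡⟨ *-distribˡ-+ 2 (T ν) (3 * N) ⟩
                           2 * T ν + 2 * (3 * N)     ≡⟨ cong (_+ 2 * (3 * N)) 2Tν≡3ν+1 ⟩
                           3 * ν + 1 + 2 * (3 * N)   ≡⟨ solve (ν ∷ N ∷ []) ⟩
                           3 * (ν + 2 * N) + 1       ∎)) ⟩
  (T ν + 3 * N) % N   ≡⟨ [m+kn]%n≡m%n (T ν) 3 N ⟩
  T ν % N             ∎
  where open ≡-Reasoning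

indicator : ∀ {p} {P : Set p} → Dec P → ℕ
indicator d = if does d then 1 else 0

indicator-yes : ∀ {p} {P : Set p} (d : Dec P) → P → indicator d ≡ 1
indicator-yes (yes _) _ = refl
indicator-yes (no ¬p) p = contradiction p ¬p

module _ {p q} {P : Set p} {Q : Set q} where

  indicator-sum≤2 : (d : Dec P) (e : Dec Q) → indicator d + indicator e ≤ 2
  indicator-sum≤2 (yes _) (yes _) = ≤-refl
  indicator-sum≤2 (yes _) (no _)  = s≤s z≤n
  indicator-sum≤2 (no _)  (yes _) = s≤s z≤n
  indicator-sum≤2 (no _)  (no _)  = z≤n

  indicator-sum-pos : (d : Dec P) (e : Dec Q) → 1 ≤ indicator d + indicator e → P ⊎ Q
  indicator-sum-pos (yes p) _       _ = inj₁ p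
  indicator-sum-pos (no _)  (yes q) _ = inj₂ q
  indicator-sum-pos (no _)  (no _)  ()

  indicator-sum≡2 : (d : Dec P) (e : Dec Q) → indicator d + indicator e ≡ 2 → P × Q
  indicator-sum≡2 (yes p) (yes q) _ = p , q
  indicator-sum≡2 (yes _) (no _)  ()
  indicator-sum≡2 (no _)  (yes _) ()
  indicator-sum≡2 (no _)  (no _)  ()

module _ {N : ℕ} .{{_ : NonZero N}} where

  edge-here : ∀ n {t} → T n % N ≡ t → 1 ≤ c N n t
  edge-here n {t} Tn≡t = ≤-trans (≤-reflexive (sym (indicator-yes (T n % N ≟ t) Tn≡t))) (m≤m+n _ _)

  edge-there : ∀ n {t} → T (n + N) % N ≡ t → 1 ≤ c N n t
  edge-there n {t} Tn+N≡t =
    ≤-trans (≤-reflexive (sym (indicator-yes (T (n + N) % N ≟ t) Tn+N≡t))) (m≤n+m _ _)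

  edge⇒image : ∀ n t → 1 ≤ c N n t → T n % N ≡ t ⊎ T (n + N) % N ≡ t
  edge⇒image n t = indicator-sum-pos (T n % N ≟ t) (T (n + N) % N ≟ t)

  c≤2 : ∀ n t → c N n t ≤ 2
  c≤2 n t = indicator-sum≤2 (T n % N ≟ t) (T (n + N) % N ≟ t)

  c≡2⇒ : ∀ n t → c N n t ≡ 2 → T n % N ≡ t × T (n + N) % N ≡ t
  c≡2⇒ n t = indicator-sum≡2 (T n % N ≟ t) (T (n + N) % N ≟ t)

  c≡2⇐ : ∀ n t → T n % N ≡ t → T (n + N) % N ≡ t → c N n t ≡ 2
  c≡2⇐ n t Tn≡t Tn+N≡t =
    cong₂ _+_ (indicator-yes (T n % N ≟ t) Tn≡t) (indicator-yes (T (n + N) % N ≟ t) Tn+N≡t)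

  edge-of-lift : ∀ ν → 1 ≤ c N (ν % N) (T ν % N)
  edge-of-lift ν =
    subst (λ x → 1 ≤ c N (ν % N) (T x % N)) (sym (m≡m%n+[m/n]*n ν N)) (lift (ν % N) (ν / N))
    where
    lift : ∀ r q → 1 ≤ c N r (T (r + q * N) % N)
    lift r zero          = edge-here r (cong (λ x → T x % N) (sym (+-identityʳ r)))
    lift r (suc zero)    = edge-there r (cong (λ x → T (r + x) % N) (sym (+-identityʳ N)))
    lift r (suc (suc q)) = subst (λ x → 1 ≤ c N r x) (sym (begin
      T (r + suc (suc q) * N) % N   ≡⟨ cong (λ x → T x % N) (regroup r q N) ⟩
      T (r + q * N + 2 * N) % N     ≡⟨ T-mod-periodic (r + q * N) N ⟩
      T (r + q * N) % N             ∎)) (lift r q)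
      where
      open ≡-Reasoning
      regroup : ∀ r q N → r + suc (suc q) * N ≡ r + q * N + 2 * N
      regroup = solve-∀

  edge-via : ∀ ν {n t} i j → ν ≡ n + i * N → T ν ≡ t + j * N → n < N → t < N → 1 ≤ c N n t
  edge-via ν i j ν≡ Tν≡ n<N t<N =
    subst₂ (λ a b → 1 ≤ c N a b) (residue-of-lift i ν≡ n<N) (residue-of-lift j Tν≡ t<N) (edge-of-lift ν)

  halving-edge : ∀ {n t} → n < N → t < N → ∀ i j → 2 * (t + j * N) ≡ n + i * N → 1 ≤ c N n t
  halving-edge {n} n<N t<N i j 2t′≡n′ = edge-via (n + i * N) i j refl (T-halve 2t′≡n′) n<N t<N

  tripling-edge : ∀ {n t} → n < N → t < N → ∀ i j →
                  2 * (t + j * N) ≡ 3 * (n + i * N) + 1 → 1 ≤ c N n t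
  tripling-edge {n} n<N t<N i j 2t′≡3n′+1 =
    edge-via (n + i * N) i j refl (T-triple {n + i * N} 2t′≡3n′+1) n<N t<N

  image-congruence : ∀ ν {n t} → ν ≡ n mod N → T ν % N ≡ t →
                     2 * t ≡ n mod N ⊎ 2 * t ≡ 3 * n + 1 mod N
  image-congruence ν {n} {t} ν≡n Tν≡t with T-spec ν
  ... | inj₁ 2Tν≡ν = inj₁ (begin
    2 * t      ≈⟨ *-congˡ-mod 2 (residue≡mod Tν≡t) ⟩
    2 * T ν    ≡⟨ 2Tν≡ν ⟩
    ν          ≈⟨ ν≡n ⟩
    n          ∎)
    where open SetoidReasoning (≡-mod-setoid N)
  ... | inj₂ 2Tν≡3ν+1 = inj₂ (begin
    2 * t      ≈⟨ *-congˡ-mod 2 (residue≡mod Tν≡t) ⟩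
    2 * T ν    ≡⟨ 2Tν≡3ν+1 ⟩
    3 * ν + 1  ≈⟨ +-cong-mod (*-congˡ-mod 3 ν≡n) refl ⟩
    3 * n + 1  ∎)
    where open SetoidReasoning (≡-mod-setoid N)

  edge⇒congruence : ∀ n t → 1 ≤ c N n t → 2 * t ≡ n mod N ⊎ 2 * t ≡ 3 * n + 1 mod N
  edge⇒congruence n t n→t with edge⇒image n t n→t
  ... | inj₁ Tn≡t   = image-congruence n refl Tn≡t
  ... | inj₂ Tn+N≡t = image-congruence (n + N) ([m+n]%n≡m%n n N) Tn+N≡t

-- Loops

module _ {N : ℕ} .{{_ : NonZero N}} where

  loop⇒ : ∀ n → n < N → 1 ≤ c N n n → n ≡ 0 ⊎ n ≡ N ∸ 1
  loop⇒ n n<N loop with edge⇒congruence n n loop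
  ... | inj₁ 2n≡n = inj₁ (≡-mod-small n<N (>-nonZero⁻¹ N) (+-cancelʳ-mod n (begin
    n + n      ≡⟨ solve (n ∷ []) ⟩
    2 * n      ≈⟨ 2n≡n ⟩
    n          ∎)))
    where open SetoidReasoning (≡-mod-setoid N)
  ... | inj₂ 2n≡3n+1 with ≡0-mod⇒multiple {k = 2} n+1≡0 n+1<2N
    where
    n+1≡0 : n + 1 ≡ 0 mod N
    n+1≡0 = +-cancelʳ-mod (2 * n) (begin
      n + 1 + 2 * n   ≡⟨ solve (n ∷ []) ⟩
      3 * n + 1       ≈⟨ sym 2n≡3n+1 ⟩
      2 * n           ∎)
      where open SetoidReasoning (≡-mod-setoid N)
    n+1<2N : n + 1 < 2 * N
    n+1<2N = begin-strict
      n + 1     ≡⟨ +-comm n 1 ⟩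
      suc n     ≤⟨ n<N ⟩
      N         <⟨ m<m+n N (>-nonZero⁻¹ N) ⟩
      N + N     ≡⟨ cong (N +_) (+-identityʳ N) ⟨
      2 * N     ∎
      where open ≤-Reasoning
  ... | 0 , _ , n+1≡0 = contradiction n+1≡0 (m+1+n≢0 n)
  ... | 1 , _ , n+1≡N = inj₂ (begin
    n               ≡⟨ m+n∸n≡m n 1 ⟨
    n + 1 ∸ 1       ≡⟨ cong (_∸ 1) (trans n+1≡N (+-identityʳ N)) ⟩
    N ∸ 1           ∎)
    where open ≡-Reasoning
  ... | suc (suc _) , s≤s (s≤s ()) , _

  loop-at-zero : 1 ≤ c N 0 0
  loop-at-zero = halving-edge (>-nonZero⁻¹ N) (>-nonZero⁻¹ N) 0 0 refl

  loop-at-top : ∀ {m} → N ≡ suc m → 1 ≤ c N m m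
  loop-at-top {m} N≡1+m = tripling-edge m<N m<N 1 2 (begin
    2 * (m + 2 * N)         ≡⟨ cong (λ x → 2 * (m + 2 * x)) N≡1+m ⟩
    2 * (m + 2 * suc m)     ≡⟨ solve (m ∷ []) ⟩
    3 * (m + 1 * suc m) + 1 ≡⟨ cong (λ x → 3 * (m + 1 * x) + 1) N≡1+m ⟨
    3 * (m + 1 * N) + 1     ∎)
    where
    open ≡-Reasoning
    m<N : m < N
    m<N = ≤-reflexive (sym N≡1+m)

  loops : ∀ n → n < N → 1 ≤ c N n n ⇔ (n ≡ 0 ⊎ n ≡ N ∸ 1)
  loops n n<N = mk⇔ (loop⇒ n n<N) loop⇐
    where
    loop⇐ : n ≡ 0 ⊎ n ≡ N ∸ 1 → 1 ≤ c N n n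
    loop⇐ (inj₁ refl) = loop-at-zero
    loop⇐ (inj₂ refl) = loop-at-top (sym (m+[n∸m]≡n (>-nonZero⁻¹ N)))

-- Strongly double edges

module _ {N : ℕ} .{{_ : NonZero N}} where

  private instance
    2N-nonZero : NonZero (N * 2)
    2N-nonZero = m*n≢0 N 2

  N<2N : N < N * 2
  N<2N = begin-strict
    N        <⟨ m<m+n N (>-nonZero⁻¹ N) ⟩
    N + N    ≡⟨ solve (N ∷ []) ⟩
    N * 2    ∎
    where open ≤-Reasoning

  ≢+N-mod-2N : ∀ x → ¬ (x ≡ x + N mod (N * 2))
  ≢+N-mod-2N x x≡x+N = ≢-nonZero⁻¹ N (sym (≡-mod-small {N * 2} (>-nonZero⁻¹ (N * 2)) N<2N
    (+-cancelˡ-mod {N * 2} x (trans (cong (_% (N * 2)) (+-identityʳ x)) x≡x+N))))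

  2T-of-upper-lift : ∀ n → 2 * T (n + N) ≡ n + N mod (N * 2)
                         ⊎ 2 * T (n + N) ≡ 3 * n + 1 + N mod (N * 2)
  2T-of-upper-lift n with T-spec (n + N)
  ... | inj₁ 2Tn+N≡n+N = inj₁ (cong (_% (N * 2)) 2Tn+N≡n+N)
  ... | inj₂ 2Tn+N≡3[n+N]+1 = inj₂ (begin
    (2 * T (n + N)) % (N * 2)                ≡⟨ cong (_% (N * 2)) 2Tn+N≡3[n+N]+1 ⟩
    (3 * (n + N) + 1) % (N * 2)              ≡⟨ cong (_% (N * 2)) (solve (n ∷ N ∷ [])) ⟩
    (3 * n + 1 + N + 1 * (N * 2)) % (N * 2)  ≡⟨ [m+kn]%n≡m%n (3 * n + 1 + N) 1 (N * 2) ⟩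
    (3 * n + 1 + N) % (N * 2)                ∎)
    where open ≡-Reasoning

  2n+1<2N : ∀ {n} → n < N → 2 * n + 1 < N * 2
  2n+1<2N {n} n<N = begin-strict
    2 * n + 1         <⟨ n<1+n (2 * n + 1) ⟩
    suc (2 * n + 1)   ≡⟨ solve (n ∷ []) ⟩
    2 * suc n         ≤⟨ *-monoʳ-≤ 2 n<N ⟩
    2 * N             ≡⟨ *-comm 2 N ⟩
    N * 2             ∎
    where open ≤-Reasoning

  3n+1≡n+N⇒N≡2n+1 : ∀ n → n < N → 3 * n + 1 ≡ n + N mod (N * 2) → N ≡ 2 * n + 1
  3n+1≡n+N⇒N≡2n+1 n n<N 3n+1≡n+N =
    sym (≡-mod-small {N * 2} (2n+1<2N n<N) N<2N (+-cancelˡ-mod {N * 2} n (begin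
      n + (2 * n + 1)   ≡⟨ solve (n ∷ []) ⟩
      3 * n + 1         ≈⟨ 3n+1≡n+N ⟩
      n + N             ∎)))
    where open SetoidReasoning (≡-mod-setoid (N * 2))

  -- Modulo 2N the doubled images 2 T n and 2 T (n + N) are n or 3n + 1, shifted by N for the
  -- upper lift; they can only agree when the two lifts take different branches of T.
  lifts-agree⇒ : ∀ n → n < N → T n ≡ T (n + N) mod N → N ≡ 2 * n + 1
  lifts-agree⇒ n n<N Tn≡Tn+N with T-spec n | 2T-of-upper-lift n
  ... | inj₁ 2Tn≡n | inj₁ upper≡n+N = contradiction (begin
    n                 ≡⟨ 2Tn≡n ⟨
    2 * T n           ≈⟨ *-scaleˡ-mod {N} 2 Tn≡Tn+N ⟩
    2 * T (n + N)     ≈⟨ upper≡n+N ⟩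
    n + N             ∎) (≢+N-mod-2N n)
    where open SetoidReasoning (≡-mod-setoid (N * 2))
  ... | inj₂ 2Tn≡3n+1 | inj₂ upper≡3n+1+N = contradiction (begin
    3 * n + 1         ≡⟨ 2Tn≡3n+1 ⟨
    2 * T n           ≈⟨ *-scaleˡ-mod {N} 2 Tn≡Tn+N ⟩
    2 * T (n + N)     ≈⟨ upper≡3n+1+N ⟩
    3 * n + 1 + N     ∎) (≢+N-mod-2N (3 * n + 1))
    where open SetoidReasoning (≡-mod-setoid (N * 2))
  ... | inj₂ 2Tn≡3n+1 | inj₁ upper≡n+N = 3n+1≡n+N⇒N≡2n+1 n n<N (begin
    3 * n + 1         ≡⟨ 2Tn≡3n+1 ⟨
    2 * T n           ≈⟨ *-scaleˡ-mod {N} 2 Tn≡Tn+N ⟩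
    2 * T (n + N)     ≈⟨ upper≡n+N ⟩
    n + N             ∎)
    where open SetoidReasoning (≡-mod-setoid (N * 2))
  ... | inj₁ 2Tn≡n | inj₂ upper≡3n+1+N = 3n+1≡n+N⇒N≡2n+1 n n<N (begin
    3 * n + 1                   ≈⟨ [m+kn]%n≡m%n (3 * n + 1) 1 (N * 2) ⟨
    3 * n + 1 + 1 * (N * 2)     ≡⟨ solve (n ∷ N ∷ []) ⟩
    3 * n + 1 + N + N           ≈⟨ +-cong-mod {N * 2} upper≡3n+1+N refl ⟨
    2 * T (n + N) + N           ≈⟨ +-cong-mod {N * 2} (*-scaleˡ-mod {N} 2 Tn≡Tn+N) refl ⟨
    2 * T n + N                 ≡⟨ cong (_+ N) 2Tn≡n ⟩
    n + N                       ∎)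
    where open SetoidReasoning (≡-mod-setoid (N * 2))

  strong⇒ : ∀ n t → n < N → c N n t ≡ 2 → N ≡ 2 * n + 1 × t ≡ T n
  strong⇒ n t n<N c≡2 with c≡2⇒ n t c≡2
  ... | Tn≡t , Tn+N≡t = N≡2n+1 , trans (sym Tn≡t) (m<n⇒m%n≡m Tn<N)
    where
    N≡2n+1 : N ≡ 2 * n + 1
    N≡2n+1 = lifts-agree⇒ n n<N (trans Tn≡t (sym Tn+N≡t))
    Tn<N : T n < N
    Tn<N = subst (T n <_) (sym N≡2n+1) (T<2n+1 n)

  upper-lift-image : ∀ n → N ≡ 2 * n + 1 → ∃ λ j → T (n + N) ≡ T n + j * N
  upper-lift-image n N≡2n+1 with T-spec n
  ... | inj₁ 2Tn≡n = 2 , T-triple {n + N} (begin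
    2 * (T n + 2 * N)           ≡⟨ *-distribˡ-+ 2 (T n) (2 * N) ⟩
    2 * T n + 2 * (2 * N)       ≡⟨ cong (_+ 2 * (2 * N)) 2Tn≡n ⟩
    n + 2 * (2 * N)             ≡⟨ cong (λ x → n + 2 * (2 * x)) N≡2n+1 ⟩
    n + 2 * (2 * (2 * n + 1))   ≡⟨ solve (n ∷ []) ⟩
    3 * (n + (2 * n + 1)) + 1   ≡⟨ cong (λ x → 3 * (n + x) + 1) N≡2n+1 ⟨
    3 * (n + N) + 1             ∎)
    where open ≡-Reasoning
  ... | inj₂ 2Tn≡3n+1 = 0 , trans (T-halve (begin
    2 * T n                     ≡⟨ 2Tn≡3n+1 ⟩
    3 * n + 1                   ≡⟨ solve (n ∷ []) ⟩
    n + (2 * n + 1)             ≡⟨ cong (n +_) N≡2n+1 ⟨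
    n + N                       ∎)) (sym (+-identityʳ (T n)))
    where open ≡-Reasoning

  strong⇐ : ∀ n t → N ≡ 2 * n + 1 → t ≡ T n → c N n t ≡ 2
  strong⇐ n t N≡2n+1 refl with upper-lift-image n N≡2n+1
  ... | j , Tn+N≡Tn+jN = c≡2⇐ n (T n) (m<n⇒m%n≡m Tn<N) (residue-of-lift j Tn+N≡Tn+jN Tn<N)
    where
    Tn<N : T n < N
    Tn<N = subst (T n <_) (sym N≡2n+1) (T<2n+1 n)

StrongEdgeClosedForm : (N : ℕ) .{{_ : NonZero N}} → ℕ → ℕ → Set
StrongEdgeClosedForm N n t =
  (N % 4 ≡ 1 × n ≡ (N ∸ 1) / 2 × t ≡ (N ∸ 1) / 4)
  ⊎ (N % 4 ≡ 3 × n ≡ (N ∸ 1) / 2 × t ≡ (3 * N ∸ 1) / 4)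

1+4k≡2[2k]+1 : ∀ k → 1 + k * 4 ≡ 2 * (k * 2) + 1
1+4k≡2[2k]+1 = solve-∀

3+4k≡2[1+2k]+1 : ∀ k → 3 + k * 4 ≡ 2 * (1 + k * 2) + 1
3+4k≡2[1+2k]+1 = solve-∀

closed-forms-1mod4 : ∀ {N} k → N ≡ 1 + k * 4 → (N ∸ 1) / 2 ≡ k * 2 × (N ∸ 1) / 4 ≡ k
closed-forms-1mod4 {N} k N≡1+4k =
  exact-quotient (k * 2) 2 (trans N∸1≡4k (sym (*-assoc k 2 2))) , exact-quotient k 4 N∸1≡4k
  where
  N∸1≡4k : N ∸ 1 ≡ k * 4
  N∸1≡4k = cong (_∸ 1) N≡1+4k

closed-forms-3mod4 : ∀ {N} k → N ≡ 3 + k * 4 → (N ∸ 1) / 2 ≡ 1 + k * 2 × (3 * N ∸ 1) / 4 ≡ 2 + 3 * k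
closed-forms-3mod4 {N} k N≡3+4k =
  exact-quotient (1 + k * 2) 2 (trans (cong (_∸ 1) N≡3+4k) (halves k)) ,
  exact-quotient (2 + 3 * k) 4 (trans (cong (λ x → 3 * x ∸ 1) N≡3+4k) (cong (_∸ 1) (quarters k)))
  where
  halves : ∀ k → 2 + k * 4 ≡ (1 + k * 2) * 2
  halves = solve-∀
  quarters : ∀ k → 3 * (3 + k * 4) ≡ 1 + (2 + 3 * k) * 4
  quarters = solve-∀

module _ {N : ℕ} .{{_ : NonZero N}} where

  strong-closed-form⇒ : ∀ n → N ≡ 2 * n + 1 → StrongEdgeClosedForm N n (T n)
  strong-closed-form⇒ n N≡2n+1 with parity n
  ... | even k = inj₁ (trans (cong (_% 4) N≡1+4k) ([m+kn]%n≡m%n 1 k 4) ,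
                       sym (proj₁ forms) , trans (T-even k) (sym (proj₂ forms)))
    where
    N≡1+4k : N ≡ 1 + k * 4
    N≡1+4k = trans N≡2n+1 (sym (1+4k≡2[2k]+1 k))
    forms : (N ∸ 1) / 2 ≡ k * 2 × (N ∸ 1) / 4 ≡ k
    forms = closed-forms-1mod4 k N≡1+4k
  ... | odd k = inj₂ (trans (cong (_% 4) N≡3+4k) ([m+kn]%n≡m%n 3 k 4) ,
                      sym (proj₁ forms) , trans (T-odd k) (sym (proj₂ forms)))
    where
    N≡3+4k : N ≡ 3 + k * 4
    N≡3+4k = trans N≡2n+1 (sym (3+4k≡2[1+2k]+1 k))
    forms : (N ∸ 1) / 2 ≡ 1 + k * 2 × (3 * N ∸ 1) / 4 ≡ 2 + 3 * k
    forms = closed-forms-3mod4 k N≡3+4k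

  strong-closed-form⇐ : ∀ n t → StrongEdgeClosedForm N n t → N ≡ 2 * n + 1 × t ≡ T n
  strong-closed-form⇐ n t (inj₁ (N%4≡1 , n≡ , t≡)) =
    trans N≡1+4k (trans (1+4k≡2[2k]+1 k) (cong (λ x → 2 * x + 1) (sym n≡2k))) ,
    trans t≡ (trans (proj₂ forms) (trans (sym (T-even k)) (cong T (sym n≡2k))))
    where
    k : ℕ
    k = N / 4
    N≡1+4k : N ≡ 1 + k * 4
    N≡1+4k = division-form 4 N%4≡1
    forms : (N ∸ 1) / 2 ≡ k * 2 × (N ∸ 1) / 4 ≡ k
    forms = closed-forms-1mod4 k N≡1+4k
    n≡2k : n ≡ k * 2
    n≡2k = trans n≡ (proj₁ forms)
  strong-closed-form⇐ n t (inj₂ (N%4≡3 , n≡ , t≡)) =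
    trans N≡3+4k (trans (3+4k≡2[1+2k]+1 k) (cong (λ x → 2 * x + 1) (sym n≡1+2k))) ,
    trans t≡ (trans (proj₂ forms) (trans (sym (T-odd k)) (cong T (sym n≡1+2k))))
    where
    k : ℕ
    k = N / 4
    N≡3+4k : N ≡ 3 + k * 4
    N≡3+4k = division-form 4 N%4≡3
    forms : (N ∸ 1) / 2 ≡ 1 + k * 2 × (3 * N ∸ 1) / 4 ≡ 2 + 3 * k
    forms = closed-forms-3mod4 k N≡3+4k
    n≡1+2k : n ≡ 1 + k * 2
    n≡1+2k = trans n≡ (proj₁ forms)

  strong⇔ : ∀ n t → n < N → c N n t ≡ 2 ⇔ StrongEdgeClosedForm N n t
  strong⇔ n t n<N = mk⇔ forward backward
    where
    forward : c N n t ≡ 2 → StrongEdgeClosedForm N n t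
    forward c≡2 with strong⇒ n t n<N c≡2
    ... | N≡2n+1 , refl = strong-closed-form⇒ n N≡2n+1
    backward : StrongEdgeClosedForm N n t → c N n t ≡ 2
    backward form with strong-closed-form⇐ n t form
    ... | N≡2n+1 , t≡Tn = strong⇐ n t N≡2n+1 t≡Tn

-- Weakly double edges

-- One orientation of each weakly double edge (SymClosure adds the other); the fifths are
-- indexed by p = N/5 - 1 so that no truncated subtraction occurs.
data WeakDoubleEdge (N : ℕ) .{{_ : NonZero N}} : ℕ → ℕ → Set where
  one-two      : WeakDoubleEdge N 1 (2 % N)
  thirds       : ∀ q → N ≡ q * 3 → WeakDoubleEdge N q (2 * q)
  outer-fifths : ∀ p → N ≡ suc p * 5 → WeakDoubleEdge N p (4 * p + 3)
  inner-fifths : ∀ p → N ≡ suc p * 5 → WeakDoubleEdge N (2 * p + 1) (3 * p + 2)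

weak-double-edge-sound : ∀ {N a b} .{{_ : NonZero N}} → 1 < N → a < N → b < N →
                         WeakDoubleEdge N a b → 1 ≤ c N a b × 1 ≤ c N b a
weak-double-edge-sound {N} 1<N _ _ one-two =
  subst (λ x → 1 ≤ c N x (2 % N)) (m<n⇒m%n≡m 1<N) (edge-of-lift 1) ,
  subst (λ x → 1 ≤ c N (2 % N) x) (m<n⇒m%n≡m 1<N) (edge-of-lift 2)
weak-double-edge-sound _ a<N b<N (thirds q refl) =
  halving-edge a<N b<N 1 0 (solve (q ∷ [])) , halving-edge b<N a<N 0 0 (solve (q ∷ []))
weak-double-edge-sound _ a<N b<N (outer-fifths p refl) =
  tripling-edge a<N b<N 1 1 (solve (p ∷ [])) , tripling-edge b<N a<N 0 1 (solve (p ∷ []))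
weak-double-edge-sound _ a<N b<N (inner-fifths p refl) =
  tripling-edge a<N b<N 0 0 (solve (p ∷ [])) , tripling-edge b<N a<N 1 2 (solve (p ∷ []))

module _ {N : ℕ} .{{_ : NonZero N}} where

  halving-third : ∀ {n t} → n < N → t < N → 2 * t ≡ n mod N → 2 * n ≡ t mod N →
                  n ≡ t ⊎ WeakDoubleEdge N t n ⊎ 3 * t ≡ 2 * N
  halving-third {n} {t} n<N t<N 2t≡n 2n≡t with ≡0-mod⇒multiple {k = 3} 3t≡0 (*-monoʳ-< 3 t<N)
    where
    3t≡0 : 3 * t ≡ 0 mod N
    3t≡0 = +-cancelʳ-mod t (begin
      3 * t + t     ≡⟨ solve (t ∷ []) ⟩
      2 * (2 * t)   ≈⟨ *-congˡ-mod 2 2t≡n ⟩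
      2 * n         ≈⟨ 2n≡t ⟩
      t             ∎)
      where open SetoidReasoning (≡-mod-setoid N)
  ... | 0 , _ , 3t≡0 = inj₁ (trans n≡0 (sym t≡0))
    where
    t≡0 : t ≡ 0
    t≡0 = m*n≡0⇒m≡0 t 3 (trans (*-comm t 3) 3t≡0)
    n≡0 : n ≡ 0
    n≡0 = ≡-mod-small n<N (>-nonZero⁻¹ N) (trans (sym 2t≡n) (cong (λ x → (2 * x) % N) t≡0))
  ... | 1 , _ , 3t≡N = inj₂ (inj₁ (subst (WeakDoubleEdge N t) (sym n≡2t) (thirds t N≡3t)))
    where
    N≡3t : N ≡ t * 3
    N≡3t = trans (sym (trans 3t≡N (+-identityʳ N))) (*-comm 3 t)
    2t<N : 2 * t < N
    2t<N = begin-strict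
      2 * t       <⟨ m<m+n (2 * t) (n≢0⇒n>0 t≢0) ⟩
      2 * t + t   ≡⟨ solve (t ∷ []) ⟩
      t * 3       ≡⟨ N≡3t ⟨
      N           ∎
      where
      open ≤-Reasoning
      t≢0 : t ≢ 0
      t≢0 t≡0 = ≢-nonZero⁻¹ N (trans N≡3t (cong (_* 3) t≡0))
    n≡2t : n ≡ 2 * t
    n≡2t = ≡-mod-small n<N 2t<N (sym 2t≡n)
  ... | 2 , _ , 3t≡2N = inj₂ (inj₂ 3t≡2N)
  ... | suc (suc (suc _)) , s≤s (s≤s (s≤s ())) , _

  halving-cycle : ∀ {n t} → n < N → t < N → n ≢ t →
                  2 * t ≡ n mod N → 2 * n ≡ t mod N → SymClosure (WeakDoubleEdge N) n t
  halving-cycle {n} {t} n<N t<N n≢t 2t≡n 2n≡t =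
    combine (halving-third n<N t<N 2t≡n 2n≡t) (halving-third t<N n<N 2n≡t 2t≡n)
    where
    combine : n ≡ t ⊎ WeakDoubleEdge N t n ⊎ 3 * t ≡ 2 * N →
              t ≡ n ⊎ WeakDoubleEdge N n t ⊎ 3 * n ≡ 2 * N → SymClosure (WeakDoubleEdge N) n t
    combine (inj₁ n≡t)        _                 = contradiction n≡t n≢t
    combine (inj₂ (inj₁ t→n)) _                 = bwd t→n
    combine _                 (inj₁ t≡n)        = contradiction (sym t≡n) n≢t
    combine _                 (inj₂ (inj₁ n→t)) = fwd n→t
    combine (inj₂ (inj₂ 3t≡2N)) (inj₂ (inj₂ 3n≡2N)) =
      contradiction (*-cancelˡ-≡ n t 3 (trans 3n≡2N (sym 3t≡2N))) n≢t

  halving-tripling-cycle : ∀ {n t} → 1 < N → n < N → t < N →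
                           2 * t ≡ n mod N → 2 * n ≡ 3 * t + 1 mod N → t ≡ 1 × n ≡ 2 % N
  halving-tripling-cycle {n} {t} 1<N n<N t<N 2t≡n 2n≡3t+1 = t≡1 , n≡2%N
    where
    t≡1 : t ≡ 1
    t≡1 = ≡-mod-small t<N 1<N (+-cancelʳ-mod (3 * t) (begin
      t + 3 * t     ≡⟨ solve (t ∷ []) ⟩
      2 * (2 * t)   ≈⟨ *-congˡ-mod 2 2t≡n ⟩
      2 * n         ≈⟨ 2n≡3t+1 ⟩
      3 * t + 1     ≡⟨ +-comm (3 * t) 1 ⟩
      1 + 3 * t     ∎))
      where open SetoidReasoning (≡-mod-setoid N)
    n≡2%N : n ≡ 2 % N
    n≡2%N = begin
      n             ≡⟨ m<n⇒m%n≡m n<N ⟨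
      n % N         ≡⟨ 2t≡n ⟨
      (2 * t) % N   ≡⟨ cong (λ x → (2 * x) % N) t≡1 ⟩
      2 % N         ∎
      where open ≡-Reasoning

  fifth-pair : ∀ {n t} → suc n + suc t ≡ N → 5 * suc t ≡ 1 * N ⊎ 5 * suc t ≡ 2 * N →
               WeakDoubleEdge N t n
  fifth-pair {n} {t} n′+t′≡N (inj₁ 5t′≡N) =
    subst (WeakDoubleEdge N t) (sym n≡4t+3) (outer-fifths t N≡5t′)
    where
    N≡5t′ : N ≡ suc t * 5
    N≡5t′ = trans (sym (trans 5t′≡N (+-identityʳ N))) (*-comm 5 (suc t))
    n≡4t+3 : n ≡ 4 * t + 3
    n≡4t+3 = suc-injective (+-cancelʳ-≡ (suc t) _ _ (begin
      suc n + suc t             ≡⟨ n′+t′≡N ⟩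
      N                         ≡⟨ N≡5t′ ⟩
      suc t * 5                 ≡⟨ solve (t ∷ []) ⟩
      suc (4 * t + 3) + suc t   ∎))
      where open ≡-Reasoning
  fifth-pair {n} {t} n′+t′≡N (inj₂ 5t′≡2N) with parity t
  ... | even k = contradiction (begin
      2 * N                 ≡⟨ 5t′≡2N ⟨
      5 * suc (k * 2)       ≡⟨ solve (k ∷ []) ⟩
      suc (2 * (5 * k + 2)) ∎) (even≢odd N (5 * k + 2))
    where open ≡-Reasoning
  ... | odd k = subst₂ (WeakDoubleEdge N) (trans (+-comm (2 * k) 1) (cong suc (*-comm 2 k)))
                       (sym n≡3k+2) (inner-fifths k N≡5k′)
    where
    open ≡-Reasoning
    N≡5k′ : N ≡ suc k * 5
    N≡5k′ = *-cancelˡ-≡ N (suc k * 5) 2 (begin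
      2 * N                 ≡⟨ 5t′≡2N ⟨
      5 * suc (1 + k * 2)   ≡⟨ solve (k ∷ []) ⟩
      2 * (suc k * 5)       ∎)
    n≡3k+2 : n ≡ 3 * k + 2
    n≡3k+2 = suc-injective (+-cancelʳ-≡ (suc (1 + k * 2)) _ _ (begin
      suc n + suc (1 + k * 2)         ≡⟨ n′+t′≡N ⟩
      N                               ≡⟨ N≡5k′ ⟩
      suc k * 5                       ≡⟨ solve (k ∷ []) ⟩
      suc (3 * k + 2) + suc (1 + k * 2) ∎))

  tripling-cycle-sum : ∀ {n t} → n < N → t < N → n ≢ t →
                       2 * t ≡ 3 * n + 1 mod N → 2 * n ≡ 3 * t + 1 mod N → suc n + suc t ≡ N
  tripling-cycle-sum {n} {t} n<N t<N n≢t 2t≡3n+1 2n≡3t+1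
    with ≡0-mod⇒multiple {k = 3} n′+t′≡0 n′+t′<3N
    where
    n′+t′≡0 : suc n + suc t ≡ 0 mod N
    n′+t′≡0 = +-cancelʳ-mod (2 * n + 2 * t) (begin
      suc n + suc t + (2 * n + 2 * t)   ≡⟨ solve (n ∷ t ∷ []) ⟩
      (3 * n + 1) + (3 * t + 1)         ≈⟨ +-cong-mod (sym 2t≡3n+1) (sym 2n≡3t+1) ⟩
      2 * t + 2 * n                     ≡⟨ +-comm (2 * t) (2 * n) ⟩
      2 * n + 2 * t                     ∎)
      where open SetoidReasoning (≡-mod-setoid N)
    n′+t′<3N : suc n + suc t < 3 * N
    n′+t′<3N = begin-strict
      suc n + suc t   ≤⟨ +-mono-≤ n<N t<N ⟩
      N + N           <⟨ m<m+n (N + N) (>-nonZero⁻¹ N) ⟩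
      N + N + N       ≡⟨ solve (N ∷ []) ⟩
      3 * N           ∎
      where open ≤-Reasoning
  ... | 1 , _ , n′+t′≡1N = trans n′+t′≡1N (+-identityʳ N)
  ... | 2 , _ , n′+t′≡2N = contradiction (suc-injective (trans n′≡N (sym t′≡N))) n≢t
    where
    n′+t′≡N+N : suc n + suc t ≡ N + N
    n′+t′≡N+N = trans n′+t′≡2N (cong (N +_) (+-identityʳ N))
    n′≡N : suc n ≡ N
    n′≡N = m+n≡o+o⇒m≡o n<N t<N n′+t′≡N+N
    t′≡N : suc t ≡ N
    t′≡N = m+n≡o+o⇒m≡o t<N n<N (trans (+-comm (suc t) (suc n)) n′+t′≡N+N)
  ... | suc (suc (suc _)) , s≤s (s≤s (s≤s ())) , _

  fifth-complement : ∀ {n t} i j → suc n + suc t ≡ N → i + j ≡ 5 → 5 * suc t ≡ j * N →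
                     5 * suc n ≡ i * N
  fifth-complement {n} {t} i j n′+t′≡N i+j≡5 5t′≡jN = +-cancelʳ-≡ (j * N) _ _ (begin
    5 * suc n + j * N         ≡⟨ cong (5 * suc n +_) 5t′≡jN ⟨
    5 * suc n + 5 * suc t     ≡⟨ *-distribˡ-+ 5 (suc n) (suc t) ⟨
    5 * (suc n + suc t)       ≡⟨ cong (5 *_) n′+t′≡N ⟩
    5 * N                     ≡⟨ cong (_* N) i+j≡5 ⟨
    (i + j) * N               ≡⟨ *-distribʳ-+ N i j ⟩
    i * N + j * N             ∎)
    where open ≡-Reasoning

  -- In terms of u = t + 1 and v = n + 1 the congruences read 2u ≡ 3v and 2v ≡ 3u, whence
  -- u + v ≡ 0 and 5u ≡ 0 (mod N).
  tripling-cycle : ∀ {n t} → n < N → t < N → n ≢ t →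
                   2 * t ≡ 3 * n + 1 mod N → 2 * n ≡ 3 * t + 1 mod N →
                   SymClosure (WeakDoubleEdge N) n t
  tripling-cycle {n} {t} n<N t<N n≢t 2t≡3n+1 2n≡3t+1 =
    by-multiple (≡0-mod⇒multiple {k = 6} 5t′≡0 5t′<6N)
    where
    n′+t′≡N : suc n + suc t ≡ N
    n′+t′≡N = tripling-cycle-sum n<N t<N n≢t 2t≡3n+1 2n≡3t+1
    t′+n′≡N : suc t + suc n ≡ N
    t′+n′≡N = trans (+-comm (suc t) (suc n)) n′+t′≡N

    5t′<6N : 5 * suc t < 6 * N
    5t′<6N = ≤-<-trans (*-monoʳ-≤ 5 t<N) (*-monoˡ-< N (n<1+n 5))

    5t′≡0 : 5 * suc t ≡ 0 mod N
    5t′≡0 = +-cancelʳ-mod (4 * t) (begin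
      5 * suc t + 4 * t       ≡⟨ solve (t ∷ []) ⟩
      3 * (3 * t + 1) + 2     ≈⟨ +-cong-mod (*-congˡ-mod 3 (sym 2n≡3t+1)) refl ⟩
      3 * (2 * n) + 2         ≡⟨ solve (n ∷ []) ⟩
      2 * (3 * n + 1)         ≈⟨ *-congˡ-mod 2 (sym 2t≡3n+1) ⟩
      2 * (2 * t)             ≡⟨ solve (t ∷ []) ⟩
      4 * t                   ∎)
      where open SetoidReasoning (≡-mod-setoid N)

    by-multiple : (∃ λ j → j < 6 × 5 * suc t ≡ j * N) → SymClosure (WeakDoubleEdge N) n t
    by-multiple (0 , _ , ())
    by-multiple (1 , _ , 5t′≡N)  = bwd (fifth-pair n′+t′≡N (inj₁ 5t′≡N))
    by-multiple (2 , _ , 5t′≡2N) = bwd (fifth-pair n′+t′≡N (inj₂ 5t′≡2N))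
    by-multiple (3 , _ , 5t′≡3N) =
      fwd (fifth-pair t′+n′≡N (inj₂ (fifth-complement 2 3 n′+t′≡N refl 5t′≡3N)))
    by-multiple (4 , _ , 5t′≡4N) =
      fwd (fifth-pair t′+n′≡N (inj₁ (fifth-complement 1 4 n′+t′≡N refl 5t′≡4N)))
    by-multiple (5 , _ , 5t′≡5N) = contradiction (begin
      N + suc n        ≡⟨ cong (_+ suc n) t′≡N ⟨
      suc t + suc n    ≡⟨ t′+n′≡N ⟩
      N                ∎) (m+1+n≢m N)
      where
      open ≡-Reasoning
      t′≡N : suc t ≡ N
      t′≡N = *-cancelˡ-≡ (suc t) N 5 5t′≡5N
    by-multiple (suc (suc (suc (suc (suc (suc _))))) , s≤s (s≤s (s≤s (s≤s (s≤s (s≤s ()))))) , _)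

  weak-double-edge-complete : ∀ {n t} → 1 < N → n < N → t < N → n ≢ t →
                              1 ≤ c N n t → 1 ≤ c N t n → SymClosure (WeakDoubleEdge N) n t
  weak-double-edge-complete {n} {t} 1<N n<N t<N n≢t n→t t→n
    with edge⇒congruence n t n→t | edge⇒congruence t n t→n
  ... | inj₁ 2t≡n     | inj₁ 2n≡t     = halving-cycle n<N t<N n≢t 2t≡n 2n≡t
  ... | inj₂ 2t≡3n+1  | inj₂ 2n≡3t+1  = tripling-cycle n<N t<N n≢t 2t≡3n+1 2n≡3t+1
  ... | inj₁ 2t≡n     | inj₂ 2n≡3t+1
      with refl , refl ← halving-tripling-cycle 1<N n<N t<N 2t≡n 2n≡3t+1 = bwd one-two
  ... | inj₂ 2t≡3n+1  | inj₁ 2n≡t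
      with refl , refl ← halving-tripling-cycle 1<N t<N n<N 2n≡t 2t≡3n+1 = fwd one-two

thirds-values : ∀ {N} q → N ≡ q * 3 → N / 3 ≡ q × (2 * N) / 3 ≡ 2 * q
thirds-values q N≡3q =
  exact-quotient q 3 N≡3q , exact-quotient (2 * q) 3 (trans (cong (2 *_) N≡3q) (sym (*-assoc 2 q 3)))

fifths-quotient : ∀ {N} p k → N ≡ suc p * 5 → (k * N) / 5 ≡ k * suc p
fifths-quotient p k N≡5p′ =
  exact-quotient (k * suc p) 5 (trans (cong (k *_) N≡5p′) (sym (*-assoc k (suc p) 5)))

-- k * suc p ∸ 1 reduces to p + (k - 1) * suc p, the form in which the identities below are stated.
outer-fifths-values : ∀ {N} p → N ≡ suc p * 5 → N / 5 ∸ 1 ≡ p × (4 * N) / 5 ∸ 1 ≡ 4 * p + 3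
outer-fifths-values p N≡5p′ =
  cong (_∸ 1) (exact-quotient (suc p) 5 N≡5p′) ,
  trans (cong (_∸ 1) (fifths-quotient p 4 N≡5p′)) (four p)
  where
  four : ∀ p → p + 3 * suc p ≡ 4 * p + 3
  four = solve-∀

inner-fifths-values : ∀ {N} p → N ≡ suc p * 5 →
                      (2 * N) / 5 ∸ 1 ≡ 2 * p + 1 × (3 * N) / 5 ∸ 1 ≡ 3 * p + 2
inner-fifths-values p N≡5p′ =
  trans (cong (_∸ 1) (fifths-quotient p 2 N≡5p′)) (two p) ,
  trans (cong (_∸ 1) (fifths-quotient p 3 N≡5p′)) (three p)
  where
  two : ∀ p → p + 1 * suc p ≡ 2 * p + 1
  two = solve-∀
  three : ∀ p → p + 2 * suc p ≡ 3 * p + 2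
  three = solve-∀

WeakEdgeClosedForm : (N : ℕ) .{{_ : NonZero N}} → ℕ → ℕ → Set
WeakEdgeClosedForm N n t =
  SamePair n t 1 (2 % N)
  ⊎ (3 ∣ N × SamePair n t (N / 3) ((2 * N) / 3))
  ⊎ (5 ∣ N × (SamePair n t (N / 5 ∸ 1) ((4 * N) / 5 ∸ 1)
              ⊎ SamePair n t ((2 * N) / 5 ∸ 1) ((3 * N) / 5 ∸ 1)))

pair-at : ∀ {a b a′ b′} → a′ ≡ a × b′ ≡ b → SamePair a b a′ b′
pair-at (refl , refl) = inj₁ (refl , refl)

pair-at-swapped : ∀ {a b a′ b′} → a′ ≡ a × b′ ≡ b → SamePair b a a′ b′
pair-at-swapped (refl , refl) = inj₂ (refl , refl)

module _ {N : ℕ} .{{_ : NonZero N}} where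

  from-pair : ∀ {a b a′ b′ n t} → WeakDoubleEdge N a b → a′ ≡ a × b′ ≡ b →
              SamePair n t a′ b′ → SymClosure (WeakDoubleEdge N) n t
  from-pair a→b (refl , refl) (inj₁ (refl , refl)) = fwd a→b
  from-pair a→b (refl , refl) (inj₂ (refl , refl)) = bwd a→b

  weak-closed-form⇒ : ∀ {n t} → SymClosure (WeakDoubleEdge N) n t → WeakEdgeClosedForm N n t
  weak-closed-form⇒ (fwd one-two) = inj₁ (inj₁ (refl , refl))
  weak-closed-form⇒ (bwd one-two) = inj₁ (inj₂ (refl , refl))
  weak-closed-form⇒ (fwd (thirds q N≡3q)) =
    inj₂ (inj₁ (divides q N≡3q , pair-at (thirds-values q N≡3q)))
  weak-closed-form⇒ (bwd (thirds q N≡3q)) =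
    inj₂ (inj₁ (divides q N≡3q , pair-at-swapped (thirds-values q N≡3q)))
  weak-closed-form⇒ (fwd (outer-fifths p N≡5p′)) =
    inj₂ (inj₂ (divides (suc p) N≡5p′ , inj₁ (pair-at (outer-fifths-values p N≡5p′))))
  weak-closed-form⇒ (bwd (outer-fifths p N≡5p′)) =
    inj₂ (inj₂ (divides (suc p) N≡5p′ , inj₁ (pair-at-swapped (outer-fifths-values p N≡5p′))))
  weak-closed-form⇒ (fwd (inner-fifths p N≡5p′)) =
    inj₂ (inj₂ (divides (suc p) N≡5p′ , inj₂ (pair-at (inner-fifths-values p N≡5p′))))
  weak-closed-form⇒ (bwd (inner-fifths p N≡5p′)) =
    inj₂ (inj₂ (divides (suc p) N≡5p′ , inj₂ (pair-at-swapped (inner-fifths-values p N≡5p′))))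

  weak-closed-form⇐ : ∀ {n t} → WeakEdgeClosedForm N n t → SymClosure (WeakDoubleEdge N) n t
  weak-closed-form⇐ (inj₁ pair) = from-pair one-two (refl , refl) pair
  weak-closed-form⇐ (inj₂ (inj₁ (divides q N≡3q , pair))) =
    from-pair (thirds q N≡3q) (thirds-values q N≡3q) pair
  weak-closed-form⇐ (inj₂ (inj₂ (divides zero N≡0 , _))) = contradiction N≡0 (≢-nonZero⁻¹ N)
  weak-closed-form⇐ (inj₂ (inj₂ (divides (suc p) N≡5p′ , inj₁ pair))) =
    from-pair (outer-fifths p N≡5p′) (outer-fifths-values p N≡5p′) pair
  weak-closed-form⇐ (inj₂ (inj₂ (divides (suc p) N≡5p′ , inj₂ pair))) =
    from-pair (inner-fifths p N≡5p′) (inner-fifths-values p N≡5p′) pair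

  weak-double-edge⇔ : ∀ {n t} → 1 < N → n < N → t < N → n ≢ t →
                      (1 ≤ c N n t × 1 ≤ c N t n) ⇔ WeakEdgeClosedForm N n t
  weak-double-edge⇔ {n} {t} 1<N n<N t<N n≢t = mk⇔
    (λ (n→t , t→n) → weak-closed-form⇒ (weak-double-edge-complete 1<N n<N t<N n≢t n→t t→n))
    (λ closed → sound (weak-closed-form⇐ closed))
    where
    sound : SymClosure (WeakDoubleEdge N) n t → 1 ≤ c N n t × 1 ≤ c N t n
    sound (fwd n→t) = weak-double-edge-sound 1<N n<N t<N n→t
    sound (bwd t→n) = swap (weak-double-edge-sound 1<N t<N n<N t→n)

-- Triple edges

N≡2[2%N]+1⇒N≡5 : ∀ {N} .{{_ : NonZero N}} → 1 < N → N ≡ 2 * (2 % N) + 1 → N ≡ 5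
N≡2[2%N]+1⇒N≡5 {1} (s≤s ()) _
N≡2[2%N]+1⇒N≡5 {2} _ ()
N≡2[2%N]+1⇒N≡5 {suc (suc (suc _))} _ refl = refl

triple-edge⇒ : ∀ {N n t} .{{_ : NonZero N}} → 1 < N → N ≡ 2 * n + 1 →
               SymClosure (WeakDoubleEdge N) n t → (N ≡ 3 ⊎ N ≡ 5) × SamePair n t 1 2
triple-edge⇒ _ N≡3 (fwd one-two) = inj₁ N≡3 , inj₁ (refl , %-congʳ N≡3)
triple-edge⇒ {N} 1<N N≡2[2%N]+1 (bwd one-two) = inj₂ N≡5 , inj₂ (%-congʳ N≡5 , refl)
  where
  N≡5 : N ≡ 5
  N≡5 = N≡2[2%N]+1⇒N≡5 1<N N≡2[2%N]+1
triple-edge⇒ _ N≡2q+1 (fwd (thirds q N≡3q)) =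
  inj₁ (trans N≡3q (cong (_* 3) q≡1)) , inj₁ (q≡1 , cong (2 *_) q≡1)
  where
  q≡1 : q ≡ 1
  q≡1 = +-cancelʳ-≡ (2 * q) q 1 (begin
    q + 2 * q     ≡⟨ solve (q ∷ []) ⟩
    q * 3         ≡⟨ trans (sym N≡3q) N≡2q+1 ⟩
    2 * q + 1     ≡⟨ +-comm (2 * q) 1 ⟩
    1 + 2 * q     ∎)
    where open ≡-Reasoning
triple-edge⇒ {N} _ N≡4q+1 (bwd (thirds q N≡3q)) = contradiction (begin
  q * 3                   ≡⟨ N≡3q ⟨
  N                       ≡⟨ N≡4q+1 ⟩
  2 * (2 * q) + 1         ≡⟨ solve (q ∷ []) ⟩
  suc (q * 3 + q)         ∎) (m≢1+m+n (q * 3))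
  where open ≡-Reasoning
triple-edge⇒ {N} _ N≡2p+1 (fwd (outer-fifths p N≡5p′)) = contradiction (begin
  2 * p + 1                       ≡⟨ N≡2p+1 ⟨
  N                               ≡⟨ N≡5p′ ⟩
  suc p * 5                       ≡⟨ solve (p ∷ []) ⟩
  suc (2 * p + 1 + (3 * p + 3))   ∎) (m≢1+m+n (2 * p + 1))
  where open ≡-Reasoning
triple-edge⇒ {N} _ N≡8p+7 (bwd (outer-fifths p N≡5p′)) = contradiction (begin
  suc p * 5                       ≡⟨ N≡5p′ ⟨
  N                               ≡⟨ N≡8p+7 ⟩
  2 * (4 * p + 3) + 1             ≡⟨ solve (p ∷ []) ⟩
  suc (suc p * 5 + (3 * p + 1))   ∎) (m≢1+m+n (suc p * 5))
  where open ≡-Reasoning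
triple-edge⇒ {N} _ N≡4p+3 (fwd (inner-fifths p N≡5p′)) = contradiction (begin
  2 * (2 * p + 1) + 1                     ≡⟨ N≡4p+3 ⟨
  N                                       ≡⟨ N≡5p′ ⟩
  suc p * 5                               ≡⟨ solve (p ∷ []) ⟩
  suc (2 * (2 * p + 1) + 1 + (p + 1))     ∎) (m≢1+m+n (2 * (2 * p + 1) + 1))
  where open ≡-Reasoning
triple-edge⇒ _ N≡6p+5 (bwd (inner-fifths p N≡5p′)) =
  inj₂ (trans N≡5p′ (cong (λ x → suc x * 5) p≡0)) ,
  inj₂ (cong (λ x → 3 * x + 2) p≡0 , cong (λ x → 2 * x + 1) p≡0)
  where
  p≡0 : p ≡ 0
  p≡0 = +-cancelˡ-≡ (suc p * 5) p 0 (begin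
    suc p * 5 + p           ≡⟨ solve (p ∷ []) ⟩
    2 * (3 * p + 2) + 1     ≡⟨ trans (sym N≡6p+5) N≡5p′ ⟩
    suc p * 5               ≡⟨ +-identityʳ (suc p * 5) ⟨
    suc p * 5 + 0           ∎)
    where open ≡-Reasoning

same-pair-sym : ∀ {n t a b} → SamePair n t a b → SamePair t n a b
same-pair-sym (inj₁ (n≡a , t≡b)) = inj₂ (t≡b , n≡a)
same-pair-sym (inj₂ (n≡b , t≡a)) = inj₁ (t≡a , n≡b)

triple-edge⇐ : ∀ {N n t} .{{_ : NonZero N}} → (N ≡ 3 ⊎ N ≡ 5) × SamePair n t 1 2 →
               c N n t + c N t n ≡ 3
triple-edge⇐ (inj₁ refl , inj₁ (refl , refl)) = refl
triple-edge⇐ (inj₁ refl , inj₂ (refl , refl)) = refl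
triple-edge⇐ (inj₂ refl , inj₁ (refl , refl)) = refl
triple-edge⇐ (inj₂ refl , inj₂ (refl , refl)) = refl

module _ {N : ℕ} .{{_ : NonZero N}} where

  not-both-strong : ∀ {n t} → n < N → t < N → n ≢ t → ¬ (c N n t ≡ 2 × c N t n ≡ 2)
  not-both-strong {n} {t} n<N t<N n≢t (n⇒t , t⇒n) =
    n≢t (*-cancelˡ-≡ n t 2 (+-cancelʳ-≡ 1 _ _ (begin
    2 * n + 1   ≡⟨ proj₁ (strong⇒ n t n<N n⇒t) ⟨
    N           ≡⟨ proj₁ (strong⇒ t n t<N t⇒n) ⟩
    2 * t + 1   ∎)))
    where open ≡-Reasoning

  triple-edge⇔ : ∀ {n t} → 1 < N → n < N → t < N → n ≢ t →
                 c N n t + c N t n ≡ 3 ⇔ ((N ≡ 3 ⊎ N ≡ 5) × SamePair n t 1 2)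
  triple-edge⇔ {n} {t} 1<N n<N t<N n≢t = mk⇔ forward triple-edge⇐
    where
    forward : c N n t + c N t n ≡ 3 → (N ≡ 3 ⊎ N ≡ 5) × SamePair n t 1 2
    forward total≡3 with sum≡3 (c≤2 n t) (c≤2 t n) total≡3
    ... | inj₁ (n⇒t , t→n) = triple-edge⇒ 1<N (proj₁ (strong⇒ n t n<N n⇒t))
      (weak-double-edge-complete 1<N n<N t<N n≢t (subst (1 ≤_) (sym n⇒t) (s≤s z≤n)) t→n)
    ... | inj₂ (n→t , t⇒n) with triple-edge⇒ 1<N (proj₁ (strong⇒ t n t<N t⇒n))
      (weak-double-edge-complete 1<N t<N n<N (n≢t ∘ sym) (subst (1 ≤_) (sym t⇒n) (s≤s z≤n)) n→t)
    ...   | N≡3∨5 , pair = N≡3∨5 , same-pair-sym pair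

lemma2p4 : (N : ℕ) .{{_ : NonZero N}} → 1 < N →
  -- (a) loops
  ((∀ n → n < N → (1 ≤ c N n n ⇔ (n ≡ 0 ⊎ n ≡ N ∸ 1)))
    × 1 ≤ c N 0 0 × 1 ≤ c N (N ∸ 1) (N ∸ 1))
  -- (b) strongly double edges
  × (∀ n t → n < N → t < N → n ≢ t →
      (c N n t ≡ 2 ⇔
        ((N % 4 ≡ 1 × n ≡ (N ∸ 1) / 2 × t ≡ (N ∸ 1) / 4)
         ⊎ (N % 4 ≡ 3 × n ≡ (N ∸ 1) / 2 × t ≡ (3 * N ∸ 1) / 4))))
  -- (c) weakly double edges
  × (∀ n t → n < N → t < N → n ≢ t →
      ((1 ≤ c N n t × 1 ≤ c N t n) ⇔
        (SamePair n t 1 (2 % N)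
         ⊎ (3 ∣ N × SamePair n t (N / 3) ((2 * N) / 3))
         ⊎ (5 ∣ N × (SamePair n t (N / 5 ∸ 1) ((4 * N) / 5 ∸ 1)
                     ⊎ SamePair n t ((2 * N) / 5 ∸ 1) ((3 * N) / 5 ∸ 1))))))
  -- (d) triple edges
  × (∀ n t → n < N → t < N → n ≢ t →
      (c N n t + c N t n ≤ 3)
      × (c N n t + c N t n ≡ 3 ⇔ ((N ≡ 3 ⊎ N ≡ 5) × SamePair n t 1 2)))
  × (N ≡ 3 → c N 1 2 ≡ 2 × c N 2 1 ≡ 1)
  × (N ≡ 5 → c N 1 2 ≡ 1 × c N 2 1 ≡ 2)
lemma2p4 N 1<N =
  (loops , loop-at-zero , loop-at-top (sym (m+[n∸m]≡n (>-nonZero⁻¹ N)))) ,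
  (λ n t n<N _ _ → strong⇔ n t n<N) ,
  (λ n t n<N t<N n≢t → weak-double-edge⇔ 1<N n<N t<N n≢t) ,
  (λ n t n<N t<N n≢t →
     sum≤3 (c≤2 n t) (c≤2 t n) (not-both-strong n<N t<N n≢t) , triple-edge⇔ 1<N n<N t<N n≢t) ,
  (λ { refl → refl , refl }) ,
  (λ { refl → refl , refl })
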